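{- The complexity function of $F(v)$ is given by $p_{F(v)}(n)=n+1$ if $n\leq n_0-l$; $p_{F(v)}(n)=2n-n_0+l+1$ if $n_0-l<n\leq n_0$; $p_{F(v)}(n)=n+l+1$ if $n>n_0$.
   Context: Let $\mathcal{A}_2=\{a,b\}$. Let $v$ be an $a$-Sturmian word (a Sturmian word, i.e. with $p_v(n)=n+1$ for all $n$, that contains $a^2$), written in the form $v=a^{l_0}ba^{l+\epsilon_1}ba^{l+\epsilon_2}ba^{l+\epsilon_3}b\cdots$ where $(\epsilon_i)_{i\geq1}$ is a Sturmian sequence over $\{0,1\}$, $l$ is an integer and $l_0\leq l+1$. Let $F$ be the cellular automaton with window length $r=l+1$ defined on words of length $l+1$ by $F(w)=a$ if $w=a^{l+1}$ and $F(w)=b$ otherwise, and extended to words by $F(w)=\varepsilon$ if $|w|<r$ and $F(xyz)=F(xy)F(yz)$ for $x$ a letter, $|y|=r-1$. Let $n_0=k_0(l+1)$, where $k_0$ is the maximum power of $a^{l+\epsilon_i}b$ in $v$. For an infinite word $u$, $p_u(n)$ denotes the number of distinct factors of length $n$ of $u$. -}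

module Defs where

open import Data.Nat using (ℕ; zero; suc; _+_; _*_)
open import Data.Bool using (Bool; true; false; if_then_else_)
open import Data.Fin using (Fin; toℕ)
open import Data.List using (List; length; lookup; replicate; concat; _∷ʳ_)
open import Data.Vec using (Vec; []; _∷_; tabulate)
open import Data.Product using (Σ; ∃; _×_; _,_; proj₁; proj₂)
open import Data.List.Membership.Propositional using (_∈_)
open import Data.List.Relation.Unary.Unique.Propositional using (Unique)
open import Function.Bundles using (_⇔_)
open import Relation.Binary.PropositionalEquality using (_≡_)

data Letter : Set where
  a b : Letter

Factor : {A : Set} → (ℕ → A) → List A → Set
Factor u w = ∃ λ i → (j : Fin (length w)) → u (i + toℕ j) ≡ lookup w j

HasComplexity : {A : Set} → (ℕ → A) → ℕ → ℕ → Set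
HasComplexity {A} u n k =
  Σ (List (List A)) λ L →
    length L ≡ k × Unique L × (∀ w → (w ∈ L) ⇔ (length w ≡ n × Factor u w))

Sturmian : {A : Set} → (ℕ → A) → Set
Sturmian u = ∀ n → HasComplexity u n (suc n)

bit : Bool → ℕ
bit false = 0
bit true  = 1

-- The word a^{lens 0} b a^{lens 1} b a^{lens 2} b ⋯ , computed by a state
-- machine: the state at position p is (number of a's still to be written in
-- the current block, index of the current block).
blockState : (ℕ → ℕ) → ℕ → ℕ × ℕ
blockState lens zero = lens 0 , 0
blockState lens (suc p) with blockState lens p
... | zero  , k = lens (suc k) , suc k
... | suc r , k = r , k

blockWord : (ℕ → ℕ) → ℕ → Letter
blockWord lens p with proj₁ (blockState lens p)
... | zero  = b
... | suc _ = a

-- Block lengths l₀, l + ε₁, l + ε₂, … ; here ε i stands for ε_{i+1}.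
vLengths : ℕ → ℕ → (ℕ → Bool) → ℕ → ℕ
vLengths l₀ l ε zero    = l₀
vLengths l₀ l ε (suc i) = l + bit (ε i)

allA : {m : ℕ} → Vec Letter m → Bool
allA []      = true
allA (a ∷ w) = allA w
allA (b ∷ w) = false

localRule : {m : ℕ} → Vec Letter m → Letter
localRule w = if allA w then a else b

applyCA : ℕ → (ℕ → Letter) → ℕ → Letter
applyCA l u i = localRule (tabulate {n = suc l} (λ j → u (i + toℕ j)))

blockPower : ℕ → ℕ → List Letter
blockPower l k = concat (replicate k (replicate l a ∷ʳ b))

{-# OPTIONS --safe #-}
-- Write F for the automaton, so that F(u)ᵢ = a exactly when u has a^{l+1} at position i.
-- The word v is gapped: every b is followed by at least l letters a, and any l + 2
-- consecutive letters contain a b.  Every factor of F(v) of length n is the image of one of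
-- the n + l + 1 factors of v of length n + l.  When the image contains an a, that a-window
-- fixes the b's around it, and walking outwards, a first disagreement between two gapped
-- preimages would create an a-window in one image opposite a b in the other; so these
-- factors have distinct images.  The remaining preimages avoid a^{l+1}, hence are windows
-- of (a^l b)^ω, and all map to bⁿ.  Sturmian words are recurrent (by Morse–Hedlund), so
-- each of them recurs late enough to be preceded by a^l, which places it inside the longest
-- power (a^l b)^{k₀} followed by a^l; there are min(l + 1, n₀ + 1 - n) of them.

module Submission where

open import Defs
open import Data.Nat using (ℕ; zero; suc; _+_; _*_; _∸_; _⊓_; _≤_; _<_; z≤n; s≤s; z<s; s<s)
open import Data.Nat.Properties
open import Data.Nat.DivMod using (_%_; _/_; m≡m%n+[m/n]*n; [m+kn]%n≡m%n; m%n<n; m<n⇒m%n≡m)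
open import Data.Nat.Induction using (<-rec)
open import Data.Nat.Tactic.RingSolver using (solve-∀)
open import Data.Bool using (Bool; true; false)
open import Data.Fin using (Fin; toℕ; fromℕ<) renaming (zero to fzero; suc to fsuc)
open import Data.Fin.Properties using (toℕ-fromℕ<; toℕ<n; pigeonhole)
open import Data.Vec using (tabulate)
open import Data.Vec.Properties using (tabulate-cong)
open import Data.List using (List; []; _∷_; _++_; _∷ʳ_; length; lookup; applyUpTo; take; map; filter; replicate; deduplicate)
open import Data.List.Properties
  using (∷-injectiveˡ; ∷-injectiveʳ; ≡-dec; length-++; length-map; length-applyUpTo; applyUpTo-∷ʳ; filter-notAll)
open import Data.List.Membership.Propositional using (_∈_)
open import Data.List.Membership.Propositional.Properties
  using (∈-map⁺; ∈-map⁻; ∈-filter⁺; ∈-filter⁻; ∈-++⁺ˡ; ∈-++⁺ʳ; ∈-++⁻; ∈-applyUpTo⁺; ∈-applyUpTo⁻; ∈-deduplicate⁺; ∈-deduplicate⁻)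
open import Data.List.Relation.Unary.Any as Any using (here; there)
open import Data.List.Relation.Unary.Any.Properties using (lookup-index)
import Data.List.Relation.Unary.All as All
open import Data.List.Relation.Unary.All.Properties using (¬Any⇒All¬)
open import Data.List.Relation.Unary.Unique.Propositional using (Unique; []; _∷_)
open import Data.List.Relation.Unary.Unique.Propositional.Properties using (Unique[x∷xs]⇒x∉xs; filter⁺; ++⁺; applyUpTo⁺₁)
open import Data.List.Relation.Unary.Unique.DecPropositional.Properties using (deduplicate-!)
open import Data.Product using (Σ; ∃; ∃₂; _×_; _,_; proj₁; proj₂)
open import Data.Sum using (inj₁; inj₂; [_,_]′)
open import Data.Empty using (⊥; ⊥-elim)
open import Function using (_∘_; _∘₂_)
open import Function.Bundles using (_⇔_; mk⇔; Equivalence)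
open import Relation.Nullary using (¬_; Dec; yes; no; ¬?; contradiction)
open import Relation.Nullary.Decidable using (decidable-stable)
open import Relation.Unary using (Pred; Decidable)
open import Relation.Binary.Definitions using (DecidableEquality)
open import Relation.Binary.PropositionalEquality


module _ {A : Set} {p} {P : Pred A p} (P? : Decidable P) where

  length-filter+filter∁ : ∀ xs → length (filter P? xs) + length (filter (¬? ∘ P?) xs) ≡ length xs
  length-filter+filter∁ []       = refl
  length-filter+filter∁ (x ∷ xs) with P? x
  ... | yes _ = cong suc (length-filter+filter∁ xs)
  ... | no  _ = trans (+-suc _ _) (cong suc (length-filter+filter∁ xs))

module _ {A : Set} (_≟_ : DecidableEquality A) where

  Unique-⊆⇒length≤ : ∀ {xs ys : List A} → Unique xs → (∀ {x} → x ∈ xs → x ∈ ys) → length xs ≤ length ys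
  Unique-⊆⇒length≤ {[]}     _                 _  = z≤n
  Unique-⊆⇒length≤ {x ∷ xs} {ys} x∷xs!@(_ ∷ xs!) xs⊆ys =
    ≤-trans (s≤s (Unique-⊆⇒length≤ xs! xs⊆ys-x))
            (filter-notAll (¬? ∘ (x ≟_)) ys (Any.map (λ x≡y x≢y → x≢y x≡y) (xs⊆ys (here refl))))
    where
    xs⊆ys-x : ∀ {y} → y ∈ xs → y ∈ filter (¬? ∘ (x ≟_)) ys
    xs⊆ys-x y∈xs = ∈-filter⁺ _ (xs⊆ys (there y∈xs)) λ { refl → Unique[x∷xs]⇒x∉xs x∷xs! y∈xs }

  Unique-⊆⊇⇒length≡ : ∀ {xs ys : List A} → Unique xs → Unique ys →
    (∀ {x} → x ∈ xs → x ∈ ys) → (∀ {x} → x ∈ ys → x ∈ xs) → length xs ≡ length ys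
  Unique-⊆⊇⇒length≡ xs! ys! xs⊆ys ys⊆xs =
    ≤-antisym (Unique-⊆⇒length≤ xs! xs⊆ys) (Unique-⊆⇒length≤ ys! ys⊆xs)

module _ {A B : Set} {f : A → B} where

  Unique-map⁺ : ∀ {xs} → (∀ {x y} → x ∈ xs → y ∈ xs → f x ≡ f y → x ≡ y) → Unique xs → Unique (map f xs)
  Unique-map⁺ {[]}     _   []          = []
  Unique-map⁺ {x ∷ xs} inj (x∉xs ∷ xs!) =
    ¬Any⇒All¬ (map f xs) fx∉ ∷ Unique-map⁺ (λ p q → inj (there p) (there q)) xs!
    where
    fx∉ : ¬ Any.Any (f x ≡_) (map f xs)
    fx∉ m with ∈-map⁻ f m
    ... | y , y∈xs , fx≡fy =
      Unique[x∷xs]⇒x∉xs (x∉xs ∷ xs!) (subst (_∈ xs) (sym (inj (here refl) (there y∈xs) fx≡fy)) y∈xs)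

module _ {A B : Set} {p} {P : Pred A p} (P? : Decidable P) (f : A → B) (c : B) where

  private
    marker : List A → List B
    marker []      = []
    marker (_ ∷ _) = c ∷ []

  compressedImage : List A → List B
  compressedImage xs = map f (filter P? xs) ++ marker (filter (¬? ∘ P?) xs)

  length-compressedImage : ∀ xs → length (compressedImage xs) ≡ length (filter P? xs) + 1 ⊓ length (filter (¬? ∘ P?) xs)
  length-compressedImage xs =
    trans (length-++ (map f (filter P? xs)))
          (cong₂ _+_ (length-map f (filter P? xs)) (marker-length (filter (¬? ∘ P?) xs)))
    where
    marker-length : ∀ ys → length (marker ys) ≡ 1 ⊓ length ys
    marker-length []      = refl
    marker-length (_ ∷ _) = refl

  module _ {xs : List A} (collapse : ∀ {x} → x ∈ xs → ¬ P x → f x ≡ c) where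

    ∈-compressedImage⇔ : ∀ {y} → y ∈ compressedImage xs ⇔ y ∈ map f xs
    ∈-compressedImage⇔ = mk⇔ to from
      where
      to : ∀ {y} → y ∈ compressedImage xs → y ∈ map f xs
      to y∈ with ∈-++⁻ (map f (filter P? xs)) y∈
      ... | inj₁ y∈map with x , x∈ , refl ← ∈-map⁻ f y∈map = ∈-map⁺ f (proj₁ (∈-filter⁻ P? x∈))
      ... | inj₂ y∈marker = marked (filter (¬? ∘ P?) xs) (λ x∈ → ∈-filter⁻ (¬? ∘ P?) x∈) y∈marker
        where
        marked : ∀ ys → (∀ {x} → x ∈ ys → x ∈ xs × ¬ P x) → ∀ {y} → y ∈ marker ys → y ∈ map f xs
        marked (x ∷ _) sub (here refl) with x∈xs , ¬Px ← sub (here refl) =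
          subst (_∈ map f xs) (collapse x∈xs ¬Px) (∈-map⁺ f x∈xs)
      from : ∀ {y} → y ∈ map f xs → y ∈ compressedImage xs
      from y∈ with x , x∈xs , refl ← ∈-map⁻ f y∈ with P? x
      ... | yes Px = ∈-++⁺ˡ (∈-map⁺ f (∈-filter⁺ P? x∈xs Px))
      ... | no ¬Px = ∈-++⁺ʳ (map f (filter P? xs))
                       (subst (_∈ marker _) (sym (collapse x∈xs ¬Px)) (marked (∈-filter⁺ (¬? ∘ P?) x∈xs ¬Px)))
        where
        marked : ∀ {x ys} → x ∈ ys → c ∈ marker ys
        marked (here _)  = here refl
        marked (there _) = here refl

  Unique-compressedImage : ∀ {xs} → Unique xs → (∀ {x y} → x ∈ xs → y ∈ xs → P x → P y → f x ≡ f y → x ≡ y) →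
                           (∀ {x} → x ∈ xs → P x → f x ≢ c) → Unique (compressedImage xs)
  Unique-compressedImage {xs} xs! inj separate =
    ++⁺ (Unique-map⁺ {xs = filter P? xs} inj′ (filter⁺ P? xs!)) (marker-unique (filter (¬? ∘ P?) xs)) disjoint
    where
    inj′ : ∀ {x y} → x ∈ filter P? xs → y ∈ filter P? xs → f x ≡ f y → x ≡ y
    inj′ x∈ y∈ = let x∈xs , Px = ∈-filter⁻ P? x∈ ; y∈xs , Py = ∈-filter⁻ P? y∈ in inj x∈xs y∈xs Px Py
    marker-unique : ∀ ys → Unique (marker ys)
    marker-unique []      = []
    marker-unique (_ ∷ _) = All.[] ∷ []
    disjoint : ∀ {y} → ¬ (y ∈ map f (filter P? xs) × y ∈ marker (filter (¬? ∘ P?) xs))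
    disjoint (y∈map , y∈marker) with x , x∈ , refl ← ∈-map⁻ f y∈map = separate x∈xs Px (at-marker _ y∈marker)
      where
      x∈xs = proj₁ (∈-filter⁻ P? {xs = xs} x∈)
      Px = proj₂ (∈-filter⁻ P? {xs = xs} x∈)
      at-marker : ∀ ys {y} → y ∈ marker ys → y ≡ c
      at-marker (_ ∷ _) (here eq) = eq

module _ {A : Set} where

  applyUpTo-cong : ∀ {f g : ℕ → A} m → (∀ {t} → t < m → f t ≡ g t) → applyUpTo f m ≡ applyUpTo g m
  applyUpTo-cong zero    _   = refl
  applyUpTo-cong (suc m) f≗g = cong₂ _∷_ (f≗g z<s) (applyUpTo-cong m (f≗g ∘ s<s))

  applyUpTo-injective : ∀ (f g : ℕ → A) m → applyUpTo f m ≡ applyUpTo g m → ∀ {t} → t < m → f t ≡ g t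
  applyUpTo-injective f g (suc m) eq {zero}  _         = ∷-injectiveˡ eq
  applyUpTo-injective f g (suc m) eq {suc t} (s<s t<m) = applyUpTo-injective (f ∘ suc) (g ∘ suc) m (∷-injectiveʳ eq) t<m

  take-applyUpTo : ∀ (f : ℕ → A) {k m} → k ≤ m → take k (applyUpTo f m) ≡ applyUpTo f k
  take-applyUpTo f z≤n       = refl
  take-applyUpTo f (s≤s k≤m) = cong (f 0 ∷_) (take-applyUpTo (f ∘ suc) k≤m)

  applyUpTo-++ : ∀ (f : ℕ → A) m n → applyUpTo f (m + n) ≡ applyUpTo f m ++ applyUpTo (λ t → f (m + t)) n
  applyUpTo-++ f zero    n = refl
  applyUpTo-++ f (suc m) n = cong (f 0 ∷_) (applyUpTo-++ (f ∘ suc) m n)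

  applyUpTo-const : ∀ (x : A) n → applyUpTo (λ _ → x) n ≡ replicate n x
  applyUpTo-const x zero    = refl
  applyUpTo-const x (suc n) = cong (x ∷_) (applyUpTo-const x n)

  applyUpTo≡⇔lookup : ∀ {f : ℕ → A} (w : List A) → applyUpTo f (length w) ≡ w ⇔ (∀ j → f (toℕ j) ≡ lookup w j)
  applyUpTo≡⇔lookup w = mk⇔ (to w) (from w)
    where
    to : ∀ {f} w → applyUpTo f (length w) ≡ w → ∀ j → f (toℕ j) ≡ lookup w j
    to (x ∷ w) eq fzero    = ∷-injectiveˡ eq
    to (x ∷ w) eq (fsuc j) = to w (∷-injectiveʳ eq) j
    from : ∀ {f} w → (∀ j → f (toℕ j) ≡ lookup w j) → applyUpTo f (length w) ≡ w
    from []      _ = refl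
    from (x ∷ w) h = cong₂ _∷_ (h fzero) (from w (h ∘ fsuc))

  window : (ℕ → A) → ℕ → ℕ → List A
  window u i = applyUpTo (λ t → u (i + t))

  window-cong : ∀ (u v : ℕ → A) {i j} m → (∀ {t} → t < m → u (i + t) ≡ v (j + t)) → window u i m ≡ window v j m
  window-cong u v m = applyUpTo-cong m

  window-≡⇒≡ : ∀ (u v : ℕ → A) {i j} m → window u i m ≡ window v j m → ∀ {t} → t < m → u (i + t) ≡ v (j + t)
  window-≡⇒≡ u v {i} {j} = applyUpTo-injective (λ t → u (i + t)) (λ t → v (j + t))

  take-window : ∀ (u : ℕ → A) i {k m} → k ≤ m → take k (window u i m) ≡ window u i k
  take-window u i = take-applyUpTo (λ t → u (i + t))

  Factor⇔window : ∀ (u : ℕ → A) w → Factor u w ⇔ ∃ λ i → window u i (length w) ≡ w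
  Factor⇔window u w = mk⇔ (λ (i , h) → i , Equivalence.from (applyUpTo≡⇔lookup w) h)
                        (λ (i , eq) → i , Equivalence.to (applyUpTo≡⇔lookup w) eq)

  window-factor : ∀ (u : ℕ → A) i m → Factor u (window u i m)
  window-factor u i m = Equivalence.from (Factor⇔window u (window u i m))
    (i , subst (λ k → window u i k ≡ window u i m) (sym (length-applyUpTo _ m)) refl)

  Factor-window⇔ : ∀ (u w : ℕ → A) j N → Factor u (window w j N) ⇔ ∃ λ p → window u p N ≡ window w j N
  Factor-window⇔ u w j N = mk⇔
    (λ factor → let p , eq = Equivalence.to (Factor⇔window u (window w j N)) factor in
                p , subst (λ k → window u p k ≡ window w j N) (length-applyUpTo _ N) eq)
    (λ (p , eq) → subst (Factor u) eq (window-factor u p N))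

  record Factors (u : ℕ → A) (m : ℕ) : Set where
    field
      words    : List (List A)
      unique   : Unique words
      sound    : ∀ {w} → w ∈ words → ∃ λ i → window u i m ≡ w
      complete : ∀ i → window u i m ∈ words

    size : ℕ
    size = length words

  open Factors public

  module _ {u : ℕ → A} {m : ℕ} where

    complexity⇒factors : ∀ {k} → HasComplexity u m k → Σ (Factors u m) λ F → size F ≡ k
    complexity⇒factors (L , |L| , L! , L⇔) = record
      { words = L ; unique = L! ; sound = sound′ ; complete = complete′ } , |L|
      where
      sound′ : ∀ {w} → w ∈ L → ∃ λ i → window u i m ≡ w
      sound′ {w} w∈L with Equivalence.to (L⇔ w) w∈L
      ... | refl , w-factor = Equivalence.to (Factor⇔window u w) w-factor
      complete′ : ∀ i → window u i m ∈ L
      complete′ i = Equivalence.from (L⇔ _) (length-applyUpTo _ m , window-factor u i m)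

    factors⇒complexity : (F : Factors u m) → HasComplexity u m (size F)
    factors⇒complexity F = words F , refl , unique F , λ w → mk⇔ (to w) (from w)
      where
      to : ∀ w → w ∈ words F → length w ≡ m × Factor u w
      to w w∈F with sound F w∈F
      ... | i , refl = length-applyUpTo _ m , window-factor u i m
      from : ∀ w → length w ≡ m × Factor u w → w ∈ words F
      from w (refl , w-factor) with Equivalence.to (Factor⇔window u w) w-factor
      ... | i , eq = subst (_∈ words F) eq (complete F i)

  module _ (_≟_ : DecidableEquality A) {u : ℕ → A} {m : ℕ} where

    size-unique : (F G : Factors u m) → size F ≡ size G
    size-unique F G = Unique-⊆⊇⇒length≡ (≡-dec _≟_) (unique F) (unique G) (F⊆ F G) (F⊆ G F)
      where
      F⊆ : (F G : Factors u m) → ∀ {w} → w ∈ words F → w ∈ words G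
      F⊆ F G w∈F with sound F w∈F
      ... | i , refl = complete G i

    truncated : ℕ → Factors u m → List (List A)
    truncated k F = deduplicate (≡-dec _≟_) (map (take k) (words F))

    restrict : ∀ {k} → k ≤ m → (F : Factors u m) → Factors u k
    restrict {k} k≤m F = record
      { words    = truncated k F
      ; unique   = deduplicate-! (≡-dec _≟_) _
      ; sound    = sound′
      ; complete = λ i → ∈-deduplicate⁺ (≡-dec _≟_)
          (subst (_∈ map (take k) (words F)) (take-window u i k≤m) (∈-map⁺ (take k) (complete F i)))
      }
      where
      sound′ : ∀ {w} → w ∈ truncated k F → ∃ λ i → window u i k ≡ w
      sound′ w∈ with ∈-map⁻ (take k) (∈-deduplicate⁻ (≡-dec _≟_) _ w∈)
      ... | x , x∈F , refl with sound F x∈F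
      ... | i , refl = i , sym (take-window u i k≤m)

module _ {A B : Set} {u : ℕ → A} {w : ℕ → B} {m n} (F : Factors u m) (Φ : List A → List B)
         (Φ-window : ∀ i → Φ (window u i m) ≡ window w i n) where

  Factors-image : (ys : List (List B)) → Unique ys → (∀ {y} → y ∈ ys ⇔ y ∈ map Φ (words F)) → Factors w n
  Factors-image ys ys! ys⇔ = record { words = ys ; unique = ys! ; sound = sound′ ; complete = complete′ }
    where
    sound′ : ∀ {y} → y ∈ ys → ∃ λ i → window w i n ≡ y
    sound′ y∈ with x , x∈F , refl ← ∈-map⁻ Φ (Equivalence.to ys⇔ y∈) with sound F x∈F
    ... | i , refl = i , sym (Φ-window i)
    complete′ : ∀ i → window w i n ∈ ys
    complete′ i = Equivalence.from ys⇔ (subst (_∈ map Φ (words F)) (Φ-window i) (∈-map⁺ Φ (complete F i)))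

padded : {A : Set} → A → List A → ℕ → A
padded d []       _       = d
padded d (x ∷ _)  zero    = x
padded d (_ ∷ xs) (suc t) = padded d xs t

padded-applyUpTo : ∀ {A : Set} (d : A) (f : ℕ → A) {m t} → t < m → padded d (applyUpTo f m) t ≡ f t
padded-applyUpTo d f {suc m} {zero}  _         = refl
padded-applyUpTo d f {suc m} {suc t} (s<s t<m) = padded-applyUpTo d (f ∘ suc) t<m

EventuallyPeriodic : {A : Set} → (ℕ → A) → Set
EventuallyPeriodic u = ∃₂ λ i j → i < j × ∀ t → u (i + t) ≡ u (j + t)

flat-step : ∀ (N : ℕ → ℕ) M → 1 ≤ N 0 → N M ≤ M → ∃ λ k → k < M × N (suc k) ≤ N k
flat-step N M N0≥1 NM≤M with anyUpTo? (λ k → N (suc k) ≤? N k) M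
... | yes found = found
... | no  none  = contradiction (≤-trans (grow M ≤-refl) NM≤M) (<⇒≱ (+-monoˡ-≤ M N0≥1))
  where
  grow : ∀ k → k ≤ M → N 0 + k ≤ N k
  grow zero    _   = ≤-reflexive (+-identityʳ (N 0))
  grow (suc k) k<M = begin
    N 0 + suc k ≡⟨ +-suc (N 0) k ⟩
    suc (N 0 + k) ≤⟨ s≤s (grow k (<⇒≤ k<M)) ⟩
    suc (N k)   ≤⟨ ≰⇒> (λ flat → none (k , k<M , flat)) ⟩
    N (suc k)   ∎
    where open ≤-Reasoning

module _ {A : Set} (_≟_ : DecidableEquality A) {u : ℕ → A} where

  private
    _≟w_ : DecidableEquality (List A)
    _≟w_ = ≡-dec _≟_

  flat⇒right-determined : ∀ {k} (F : Factors u k) (G : Factors u (suc k)) → size G ≤ size F →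
    ∀ {i j} → window u i k ≡ window u j k → u (i + k) ≡ u (j + k)
  flat⇒right-determined {k} F G G≤F {i} {j} same with u (i + k) ≟ u (j + k)
  ... | yes eq = eq
  ... | no  ne = contradiction G≤F (<⇒≱ F<G)
    where
    wᵢ = window u i (suc k)
    wⱼ = window u j (suc k)
    others = filter (λ w → ¬? (w ≟w wⱼ)) (words G)
    wᵢ≢wⱼ : wᵢ ≢ wⱼ
    wᵢ≢wⱼ eq = ne (window-≡⇒≡ u u (suc k) eq ≤-refl)
    F⊆ : ∀ {x} → x ∈ words F → x ∈ map (take k) others
    F⊆ x∈F with sound F x∈F
    ... | h , refl with window u h (suc k) ≟w wⱼ
    ... | no  ≢wⱼ = subst (_∈ map (take k) others) (take-window u h (n≤1+n k)) (∈-map⁺ (take k) (∈-filter⁺ _ (complete G h) ≢wⱼ))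
    ... | yes ≡wⱼ = subst (_∈ map (take k) others) eq (∈-map⁺ (take k) (∈-filter⁺ _ (complete G i) wᵢ≢wⱼ))
      where
      eq : take k wᵢ ≡ window u h k
      eq = begin
        take k wᵢ                   ≡⟨ take-window u i (n≤1+n k) ⟩
        window u i k                ≡⟨ same ⟩
        window u j k                ≡⟨ take-window u j (n≤1+n k) ⟨
        take k wⱼ                   ≡⟨ cong (take k) ≡wⱼ ⟨
        take k (window u h (suc k)) ≡⟨ take-window u h (n≤1+n k) ⟩
        window u h k                ∎
        where open ≡-Reasoning
    F<G : size F < size G
    F<G = ≤-<-trans (≤-trans (Unique-⊆⇒length≤ _≟w_ (unique F) F⊆) (≤-reflexive (length-map (take k) others)))
                    (filter-notAll _ (words G) (Any.map (λ wⱼ≡w w≢wⱼ → w≢wⱼ (sym wⱼ≡w)) (complete G j)))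

  right-determined⇒synchronised : ∀ {k} → (∀ {i j} → window u i k ≡ window u j k → u (i + k) ≡ u (j + k)) →
    ∀ {i j} → window u i k ≡ window u j k → ∀ t → u (i + t) ≡ u (j + t)
  right-determined⇒synchronised {k} determined {i} {j} same = <-rec _ step
    where
    step : ∀ t → (∀ {s} → s < t → u (i + s) ≡ u (j + s)) → u (i + t) ≡ u (j + t)
    step t before with k ≤? t
    ... | no  t≱k = window-≡⇒≡ u u k same (≰⇒> t≱k)
    ... | yes k≤t with s , refl ← m≤n⇒∃[o]m+o≡n k≤t = begin
      u (i + (k + s)) ≡⟨ cong u (reassoc i) ⟩
      u (i + s + k)   ≡⟨ determined (window-cong u u k λ {r} r<k → shifted (+-monoʳ-< s r<k)) ⟩
      u (j + s + k)   ≡⟨ cong u (reassoc j) ⟨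
      u (j + (k + s)) ∎
      where
      open ≡-Reasoning
      reassoc : ∀ x → x + (k + s) ≡ x + s + k
      reassoc x = trans (cong (x +_) (+-comm k s)) (sym (+-assoc x s k))
      shifted : ∀ {r} → s + r < s + k → u (i + s + r) ≡ u (j + s + r)
      shifted {r} r< = trans (cong u (+-assoc i s r))
                             (trans (before (subst (s + r <_) (+-comm s k) r<)) (cong u (sym (+-assoc j s r))))

  repeated-window : ∀ {k} (F : Factors u k) → ∃₂ λ i j → i < j × window u i k ≡ window u j k
  repeated-window {k} F with pigeonhole ≤-refl (λ x → Any.index (complete F (toℕ x)))
  ... | x , y , x<y , same-index =
    toℕ x , toℕ y , x<y , trans (lookup-index (complete F (toℕ x)))
                                (trans (cong (lookup (words F)) same-index) (sym (lookup-index (complete F (toℕ y)))))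

  eventually-periodic⇒size≤ : ∀ {i j} → i < j → (∀ t → u (i + t) ≡ u (j + t)) → (F : Factors u j) → size F ≤ j
  eventually-periodic⇒size≤ {i} {j} i<j periodic F =
    ≤-trans (Unique-⊆⇒length≤ (≡-dec _≟_) (unique F) F⊆) (≤-reflexive (length-applyUpTo _ j))
    where
    early : ∀ x → ∃ λ y → y < j × window u x j ≡ window u y j
    early = <-rec _ reduce
      where
      reduce : ∀ x → (∀ {y} → y < x → ∃ λ z → z < j × window u y j ≡ window u z j) →
               ∃ λ z → z < j × window u x j ≡ window u z j
      reduce x earlier with x <? j
      ... | yes x<j = x , x<j , refl
      ... | no  x≮j with r , refl ← m≤n⇒∃[o]m+o≡n (≮⇒≥ x≮j) with earlier (+-monoˡ-< r i<j)
      ... | z , z<j , eq = z , z<j , trans (window-cong u u j λ {t} _ →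
              trans (cong u (+-assoc j r t)) (trans (sym (periodic (r + t))) (cong u (sym (+-assoc i r t))))) eq
    F⊆ : ∀ {w} → w ∈ words F → w ∈ applyUpTo (λ y → window u y j) j
    F⊆ w∈F with sound F w∈F
    ... | x , refl with early x
    ... | y , y<j , eq = subst (_∈ _) (sym eq) (∈-applyUpTo⁺ _ y<j)

  morse-hedlund : ∀ {M} (F : Factors u M) → size F ≤ M → EventuallyPeriodic u
  morse-hedlund {M} F F≤M = periodic (flat-step N M N0≥1 NM≤M)
    where
    N : ℕ → ℕ
    N k = length (truncated _≟_ k F)
    nonempty : ∀ {x : List A} {xs} → x ∈ xs → 1 ≤ length xs
    nonempty (here _)  = s≤s z≤n
    nonempty (there _) = s≤s z≤n
    N0≥1 : 1 ≤ N 0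
    N0≥1 = nonempty (complete (restrict _≟_ z≤n F) 0)
    NM≤M : N M ≤ M
    NM≤M = ≤-trans (≤-reflexive (size-unique _≟_ (restrict _≟_ ≤-refl F) F)) F≤M
    periodic : (∃ λ k → k < M × N (suc k) ≤ N k) → EventuallyPeriodic u
    periodic (k , k<M , flat) with i , j , i<j , same ← repeated-window (restrict _≟_ (<⇒≤ k<M) F) =
      i , j , i<j , right-determined⇒synchronised
                      (flat⇒right-determined (restrict _≟_ (<⇒≤ k<M) F) (restrict _≟_ k<M F) flat) same

module _ {A : Set} (_≟_ : DecidableEquality A) {u : ℕ → A} where

  sturmian⇒¬eventually-periodic : Sturmian u → ¬ EventuallyPeriodic u
  sturmian⇒¬eventually-periodic sturmian (i , j , i<j , periodic)
    with F , |F| ← complexity⇒factors (sturmian j) =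
    contradiction (subst (_≤ j) |F| (eventually-periodic⇒size≤ _≟_ {u} i<j periodic F)) 1+n≰n

  -- If the prefix of length M never recurred, dropping it would leave u ∘ suc with at most
  -- M factors of length M, making u eventually periodic.
  prefix-recurs : Sturmian u → ∀ M → ¬ ¬ ∃ λ p → window u (suc p) M ≡ window u 0 M
  prefix-recurs sturmian M never with F , |F| ← complexity⇒factors (sturmian M) =
    sturmian⇒¬eventually-periodic sturmian (shift-back (morse-hedlund _≟_ tail-factors tail-size))
    where
    prefix = window u 0 M
    ¬prefix? = λ w → ¬? (≡-dec _≟_ w prefix)
    tail-factors : Factors (u ∘ suc) M
    tail-factors = record
      { words    = filter ¬prefix? (words F)
      ; unique   = filter⁺ ¬prefix? (unique F)
      ; sound    = sound′
      ; complete = λ p → ∈-filter⁺ ¬prefix? (complete F (suc p)) (λ eq → never (p , eq))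
      }
      where
      sound′ : ∀ {w} → w ∈ filter ¬prefix? (words F) → ∃ λ p → window (u ∘ suc) p M ≡ w
      sound′ w∈ with w∈F , w≢prefix ← ∈-filter⁻ ¬prefix? w∈ with sound F w∈F
      ... | zero  , refl = contradiction refl w≢prefix
      ... | suc p , refl = p , refl
    tail-size : size tail-factors ≤ M
    tail-size = ≤-pred (subst (size tail-factors <_) |F|
      (filter-notAll ¬prefix? (words F) (Any.map (λ prefix≡w w≢prefix → w≢prefix (sym prefix≡w)) (complete F 0))))
    shift-back : EventuallyPeriodic (u ∘ suc) → EventuallyPeriodic u
    shift-back (i , j , i<j , periodic) = suc i , suc j , s<s i<j , periodic

  recurs-later : Sturmian u → ∀ i m → ¬ ¬ ∃ λ i′ → i < i′ × window u i′ m ≡ window u i m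
  recurs-later sturmian i m later = prefix-recurs sturmian (i + m) λ (p , eq) →
    later (suc p + i , s≤s (m≤n+m i p) , window-cong u u m λ {t} t<m →
             trans (cong u (+-assoc (suc p) i t)) (window-≡⇒≡ u u (i + m) eq (+-monoʳ-< i t<m)))

  recurs-beyond : Sturmian u → ∀ i m K → ¬ ¬ ∃ λ i′ → K ≤ i′ × window u i′ m ≡ window u i m
  recurs-beyond sturmian i m zero    found = found (i , z≤n , refl)
  recurs-beyond sturmian i m (suc K) found = recurs-beyond sturmian i m K λ (i₁ , K≤i₁ , eq₁) →
    recurs-later sturmian i₁ m λ (i₂ , i₁<i₂ , eq₂) → found (i₂ , ≤-trans (s≤s K≤i₁) i₁<i₂ , trans eq₂ eq₁)

_≟ₗ_ : DecidableEquality Letter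
a ≟ₗ a = yes refl
a ≟ₗ b = no λ ()
b ≟ₗ a = no λ ()
b ≟ₗ b = yes refl

a≢b : a ≢ b
a≢b ()

≢a⇒≡b : ∀ {x} → x ≢ a → x ≡ b
≢a⇒≡b {a} x≢a = ⊥-elim (x≢a refl)
≢a⇒≡b {b} _   = refl

allA-true⇒ : ∀ {m} (f : Fin m → Letter) → allA (tabulate f) ≡ true → ∀ j → f j ≡ a
allA-true⇒ {suc m} f all j with f fzero in f₀
allA-true⇒ {suc m} f all fzero    | a = f₀
allA-true⇒ {suc m} f all (fsuc j) | a = allA-true⇒ (f ∘ fsuc) all j

⇒allA-true : ∀ {m} (f : Fin m → Letter) → (∀ j → f j ≡ a) → allA (tabulate f) ≡ true
⇒allA-true {zero}  f _   = refl
⇒allA-true {suc m} f all rewrite all fzero = ⇒allA-true (f ∘ fsuc) (all ∘ fsuc)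

module _ (l : ℕ) where

  applyCA-cong : ∀ (u v : ℕ → Letter) {i j} → (∀ {t} → t ≤ l → u (i + t) ≡ v (j + t)) → applyCA l u i ≡ applyCA l v j
  applyCA-cong u v same = cong localRule (tabulate-cong λ t → same (≤-pred (toℕ<n t)))

  applyCA≡a⇒ : ∀ (u : ℕ → Letter) {i} → applyCA l u i ≡ a → ∀ {t} → t ≤ l → u (i + t) ≡ a
  applyCA≡a⇒ u {i} eq {t} t≤l with allA (tabulate {n = suc l} (λ j → u (i + toℕ j))) in all
  ... | true  = subst (λ s → u (i + s) ≡ a) (toℕ-fromℕ< (s≤s t≤l)) (allA-true⇒ (λ j → u (i + toℕ j)) all (fromℕ< (s≤s t≤l)))
  ... | false = ⊥-elim (a≢b (sym eq))

  ⇒applyCA≡a : ∀ (u : ℕ → Letter) {i} → (∀ {t} → t ≤ l → u (i + t) ≡ a) → applyCA l u i ≡ a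
  ⇒applyCA≡a u {i} all rewrite ⇒allA-true {suc l} (λ j → u (i + toℕ j)) (λ j → all (≤-pred (toℕ<n j))) = refl

  ⇒applyCA≡b : ∀ (u : ℕ → Letter) {i t} → t ≤ l → u (i + t) ≡ b → applyCA l u i ≡ b
  ⇒applyCA≡b u {i} t≤l uₜ = ≢a⇒≡b λ eq → a≢b (trans (sym (applyCA≡a⇒ u {i} eq t≤l)) uₜ)

  applyCA-shift : ∀ (u : ℕ → Letter) i x → applyCA l (λ t → u (i + t)) x ≡ applyCA l u (i + x)
  applyCA-shift u i x = applyCA-cong (λ t → u (i + t)) u (λ {t} _ → cong u (sym (+-assoc i x t)))

AsBetween : (ℕ → Letter) → ℕ → ℕ → Set
AsBetween f s e = ∀ {t} → s < t → t < e → f t ≡ a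

module _ (f : ℕ → Letter) where

  first-b-from : ∀ i {d} → f (i + d) ≡ b → ∃ λ r → r ≤ d × f (i + r) ≡ b × (∀ {t} → t < r → f (i + t) ≡ a)
  first-b-from i {d} found with f i in fᵢ
  ... | b = 0 , z≤n , trans (cong f (+-identityʳ i)) fᵢ , λ ()
  first-b-from i {zero}  found | a = ⊥-elim (a≢b (trans (sym fᵢ) (trans (cong f (sym (+-identityʳ i))) found)))
  first-b-from i {suc d} found | a with r , r≤d , fᵣ , before ← first-b-from (suc i) (trans (cong f (sym (+-suc i d))) found) =
    suc r , s≤s r≤d , trans (cong f (+-suc i r)) fᵣ , earlier
    where
    earlier : ∀ {t} → t < suc r → f (i + t) ≡ a
    earlier {zero}  _         = trans (cong f (+-identityʳ i)) fᵢ
    earlier {suc t} (s<s t<r) = trans (cong f (+-suc i t)) (before t<r)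

  last-b-before : ∀ {s e} → s < e → f s ≡ b → ∃ λ σ → s ≤ σ × σ < e × f σ ≡ b × AsBetween f σ e
  last-b-before {s} {suc e} (s≤s s≤e) fₛ with m≤n⇒m<n∨m≡n s≤e
  ... | inj₂ refl = s , ≤-refl , ≤-refl , fₛ , λ s<t t<1+s → ⊥-elim (<⇒≱ s<t (≤-pred t<1+s))
  ... | inj₁ s<e with f e in fₑ
  ...   | b = e , <⇒≤ s<e , ≤-refl , fₑ , λ e<t t<1+e → ⊥-elim (<⇒≱ e<t (≤-pred t<1+e))
  ...   | a with σ , s≤σ , σ<e , f_σ , between ← last-b-before s<e fₛ =
    σ , s≤σ , m≤n⇒m≤1+n σ<e , f_σ ,
    λ σ<t t<1+e → [ between σ<t , (λ { refl → fₑ }) ]′ (m≤n⇒m<n∨m≡n (≤-pred t<1+e))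

record Gapped (l : ℕ) (f : ℕ → Letter) : Set where
  field
    b-ahead   : ∀ p → ∃ λ t → t ≤ suc l × f (p + t) ≡ b
    a-after-b : ∀ {s t} → f s ≡ b → t < l → f (s + suc t) ≡ a

open Gapped public

Agree : (ℕ → Letter) → (ℕ → Letter) → ℕ → ℕ → Set
Agree f g s e = ∀ {t} → s ≤ t → t < e → f t ≡ g t

module _ {l} {f : ℕ → Letter} (gapped : Gapped l f) where

  b-gap : ∀ {s e} → s < e → f s ≡ b → f e ≡ b → l + s < e
  b-gap {s} {e} s<e fₛ fₑ with l + s <? e
  ... | yes l+s<e = l+s<e
  ... | no  l+s≮e with t , refl ← m≤n⇒∃[o]m+o≡n s<e =
    contradiction (trans (sym (a-after-b gapped fₛ t<l)) (trans (cong f (+-suc s t)) fₑ)) a≢b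
    where
    t<l : t < l
    t<l = +-cancelˡ-< s t l (subst (s + t <_) (+-comm l s) (≮⇒≥ l+s≮e))

  -- The bound on p provides an earlier b (b-ahead at p ∸ 2): the first block of a's may be short.
  a-before-b : ∀ {p t} → 2 ≤ p → f (p + l) ≡ b → t < l → f (p + t) ≡ a
  a-before-b {suc (suc y)} {t} (s≤s (s≤s z≤n)) fₑ t<l
    with τ , τ≤ , f_yτ ← b-ahead gapped y
    with σ , _ , σ<e , f_σ , between ← last-b-before f (≤-<-trans (+-monoʳ-≤ y τ≤) (s≤s (≤-reflexive (+-suc y l)))) f_yτ =
    between (<-≤-trans σ<p (m≤m+n _ t)) (+-monoʳ-< (suc (suc y)) t<l)
    where
    σ<p : σ < suc (suc y)
    σ<p = +-cancelʳ-< l σ _ (subst (_< suc (suc y) + l) (+-comm l σ) (b-gap σ<e f_σ fₑ))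

  b-after-a-window : ∀ {p} → applyCA l f p ≡ a → f (p + suc l) ≡ b
  b-after-a-window {p} window with τ , τ≤ , f_pτ ← b-ahead gapped p with m≤n⇒m<n∨m≡n τ≤
  ... | inj₂ refl = f_pτ
  ... | inj₁ τ<1+l = contradiction (trans (sym (applyCA≡a⇒ l f window (≤-pred τ<1+l))) f_pτ) a≢b

Gapped-shift : ∀ {l f} → Gapped l f → ∀ i → Gapped l (λ t → f (i + t))
Gapped-shift {l} {f} gapped i = record
  { b-ahead   = λ p → let τ , τ≤ , f_τ = b-ahead gapped (i + p) in τ , τ≤ , trans (cong f (sym (+-assoc i p τ))) f_τ
  ; a-after-b = λ {s} {t} fₛ t<l → trans (cong f (sym (+-assoc i s (suc t)))) (a-after-b gapped fₛ t<l)
  }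

Gapped-resp : ∀ {l f g} → (∀ t → f t ≡ g t) → Gapped l f → Gapped l g
Gapped-resp {l} {f} {g} f≗g gapped = record
  { b-ahead   = λ p → let τ , τ≤ , f_τ = b-ahead gapped p in τ , τ≤ , trans (sym (f≗g _)) f_τ
  ; a-after-b = λ gₛ t<l → trans (sym (f≗g _)) (a-after-b gapped (trans (f≗g _) gₛ) t<l)
  }

data Clash (l : ℕ) (f g : ℕ → Letter) (x : ℕ) : Set where
  clash : applyCA l f x ≡ a → applyCA l g x ≡ b → Clash l f g x

Clash⇒≢ : ∀ {l f g x} → Clash l f g x → applyCA l f x ≢ applyCA l g x
Clash⇒≢ (clash fa gb) same = a≢b (trans (sym fa) (trans same gb))

≡-unless-mismatch : ∀ {x y} → (x ≡ a → y ≡ b → ⊥) → (y ≡ a → x ≡ b → ⊥) → x ≡ y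
≡-unless-mismatch {a} {a} _ _ = refl
≡-unless-mismatch {a} {b} h _ = ⊥-elim (h refl refl)
≡-unless-mismatch {b} {a} _ h = ⊥-elim (h refl refl)
≡-unless-mismatch {b} {b} _ _ = refl

Agree-join : ∀ {f g : ℕ → Letter} {s m e} → Agree f g s m → Agree f g m e → Agree f g s e
Agree-join {m = m} left right {t} s≤t t<e with t <? m
... | yes t<m = left s≤t t<m
... | no  t≮m = right (≮⇒≥ t≮m) t<e

module _ {l} {f g : ℕ → Letter} (gf : Gapped l f) (gg : Gapped l g) where

  -- The last b of f before q is also a b of g, whose next b is at q; so f has a^{l+1} ending at q.
  mismatch-right : ∀ {s q} → s < q → f s ≡ b → Agree f g s q → f q ≡ a → g q ≡ b →
                   ∃ λ x → x + l ≡ q × Clash l f g x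
  mismatch-right {s} {q} s<q fₛ agree f_q g_q
    with σ , s≤σ , σ<q , f_σ , between ← last-b-before f s<q fₛ
    with o , refl ← m≤n⇒∃[o]m+o≡n (b-gap gg σ<q (trans (sym (agree s≤σ σ<q)) f_σ) g_q) =
    suc σ + o , x+l≡q ,
    clash (⇒applyCA≡a l f f-window) (⇒applyCA≡b l g {suc σ + o} ≤-refl (subst (λ z → g z ≡ b) (sym x+l≡q) g_q))
    where
    x+l≡q : suc σ + o + l ≡ suc (l + σ) + o
    x+l≡q = cong suc (trans (+-comm (σ + o) l) (sym (+-assoc l σ o)))
    f-window : ∀ {t} → t ≤ l → f (suc σ + o + t) ≡ a
    f-window {t} t≤l with m≤n⇒m<n∨m≡n t≤l
    ... | inj₁ t<l  = between (s≤s (≤-trans (m≤m+n σ o) (m≤m+n _ t)))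
                              (subst (suc σ + o + t <_) x+l≡q (+-monoʳ-< (suc σ + o) t<l))
    ... | inj₂ refl = subst (λ z → f z ≡ a) (sym x+l≡q) f_q

  -- The first b of f after x is also a b of g, hence more than l letters after x.
  mismatch-left : ∀ {x} → Agree f g (suc x) (suc x + suc l) → f x ≡ a → g x ≡ b → Clash l f g x
  mismatch-left {x} agree fₓ gₓ
    with τ , τ≤ , f_xτ ← b-ahead gf x
    with first-b-from f x f_xτ
  ... | zero , _ , f_x0 , _ = contradiction (trans (sym fₓ) (trans (cong f (sym (+-identityʳ x))) f_x0)) a≢b
  ... | suc r , r<τ , f_xr , before =
    clash (⇒applyCA≡a l f (λ t≤l → before (s≤s (≤-trans t≤l l≤r))))
          (⇒applyCA≡b l g {x} {0} z≤n (trans (cong g (+-identityʳ x)) gₓ))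
    where
    g_xr : g (x + suc r) ≡ b
    g_xr = trans (sym (agree (≤-trans (s≤s (m≤m+n x r)) (≤-reflexive (sym (+-suc x r))))
                             (s≤s (+-monoʳ-≤ x (≤-trans r<τ τ≤)))))
                 f_xr
    l≤r : l ≤ r
    l≤r = ≤-pred (+-cancelˡ-< x l (suc r) (subst (_< x + suc r) (+-comm l x) (b-gap gg (m<m+n x z<s) gₓ g_xr)))

  agree-on-a-window : ∀ {p} → applyCA l f p ≡ a → applyCA l g p ≡ a → Agree f g p (suc (p + l))
  agree-on-a-window {p} f-window g-window p≤t t≤p+l with o , refl ← m≤n⇒∃[o]m+o≡n p≤t =
    trans (applyCA≡a⇒ l f f-window o≤l) (sym (applyCA≡a⇒ l g g-window o≤l))
    where
    o≤l = +-cancelˡ-≤ p o l (≤-pred t≤p+l)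

module _ {l} {f g : ℕ → Letter} (gf : Gapped l f) (gg : Gapped l g) where

  agree-rightwards : ∀ {s} Q → f s ≡ b → g s ≡ b → (∀ {x} → x + l < Q → applyCA l f x ≡ applyCA l g x) →
                     Agree f g s Q
  agree-rightwards (suc Q) fₛ gₛ same {t} s≤t t<1+Q with m≤n⇒m<n∨m≡n (≤-pred t<1+Q) | m≤n⇒m<n∨m≡n s≤t
  ... | inj₁ t<Q  | _         = earlier s≤t t<Q
    where earlier = agree-rightwards Q fₛ gₛ (same ∘ m<n⇒m<1+n)
  ... | inj₂ refl | inj₂ refl = trans fₛ (sym gₛ)
  ... | inj₂ refl | inj₁ s<t  = ≡-unless-mismatch
    (λ f_t g_t → let x , x+l≡t , clashing = mismatch-right gf gg s<t fₛ earlier f_t g_t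
                 in Clash⇒≢ clashing (same (≤-reflexive (cong suc x+l≡t))))
    (λ g_t f_t → let x , x+l≡t , clashing = mismatch-right gg gf s<t gₛ (sym ∘₂ earlier) g_t f_t
                 in Clash⇒≢ clashing (sym (same (≤-reflexive (cong suc x+l≡t)))))
    where earlier = agree-rightwards Q fₛ gₛ (same ∘ m<n⇒m<1+n)

  agree-leftwards : ∀ {p E} → p + l < E → (∀ {x} → x < p → applyCA l f x ≡ applyCA l g x) →
                    Agree f g p E → Agree f g 0 E
  agree-leftwards {zero}  _     _    agree = agree
  agree-leftwards {suc x} x+l<E same agree =
    agree-leftwards (<-trans (n<1+n (x + l)) x+l<E) (same ∘ m<n⇒m<1+n) (Agree-join at-x agree)
    where
    near : Agree f g (suc x) (suc x + suc l)
    near {t} s≤t t< = agree s≤t (≤-<-trans (≤-pred (subst (t <_) (+-suc (suc x) l) t<)) x+l<E)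
    at-x : Agree f g x (suc x)
    at-x {t} x≤t t<1+x with ≤-antisym x≤t (≤-pred t<1+x)
    ... | refl = ≡-unless-mismatch (λ fₓ gₓ → Clash⇒≢ (mismatch-left gf gg near fₓ gₓ) (same ≤-refl))
                                   (λ gₓ fₓ → Clash⇒≢ (mismatch-left gg gf (sym ∘₂ near) gₓ fₓ) (sym (same ≤-refl)))

  applyCA-injective : ∀ {n p₀} → (∀ {x} → x < n → applyCA l f x ≡ applyCA l g x) →
                      p₀ < n → applyCA l f p₀ ≡ a → Agree f g 0 (n + l)
  applyCA-injective {n} {p₀} same p₀<n f-window =
    Agree-join (agree-leftwards ≤-refl (λ x<p₀ → same (<-trans x<p₀ p₀<n)) (agree-on-a-window gf gg f-window g-window))
               (subst (λ s → Agree f g s (n + l)) (+-suc p₀ l)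
                 (agree-rightwards (n + l) (b-after-a-window gf f-window) (b-after-a-window gg g-window)
                                   (λ x+l<n+l → same (+-cancelʳ-< l _ n x+l<n+l))))
    where
    g-window : applyCA l g p₀ ≡ a
    g-window = trans (sym (same p₀<n)) f-window

residueLetter : ℕ → ℕ → Letter
residueLetter l r with r ≟ l
... | yes _ = b
... | no  _ = a

blockPowerω : ℕ → ℕ → Letter
blockPowerω l t = residueLetter l (t % suc l)

module _ {l : ℕ} where

  private
    ρ = blockPowerω l

  blockPowerω-periodic : ∀ t c → ρ (t + c * suc l) ≡ ρ t
  blockPowerω-periodic t c = cong (residueLetter l) ([m+kn]%n≡m%n t c (suc l))

  blockPowerω-suc-l : ∀ t → ρ (suc l + t) ≡ ρ t
  blockPowerω-suc-l t =
    trans (cong ρ (trans (+-comm (suc l) t) (cong (t +_) (sym (+-identityʳ (suc l)))))) (blockPowerω-periodic t 1)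

  blockPowerω-a : ∀ {t} → t < l → ρ t ≡ a
  blockPowerω-a {t} t<l rewrite m<n⇒m%n≡m {n = suc l} (m<n⇒m<1+n t<l) with t ≟ l
  ... | yes refl = contradiction t<l (n≮n t)
  ... | no  _    = refl

  blockPowerω-b : ρ l ≡ b
  blockPowerω-b rewrite m<n⇒m%n≡m {n = suc l} (n<1+n l) with l ≟ l
  ... | yes _   = refl
  ... | no  l≢l = contradiction refl l≢l

  blockPowerω-reduce : ∀ s → ∃ λ r → r ≤ l × ∀ t → ρ (s + t) ≡ ρ (r + t)
  blockPowerω-reduce s = s % suc l , ≤-pred (m%n<n s (suc l)) , λ t → begin
    ρ (s + t)                                   ≡⟨ cong (λ x → ρ (x + t)) (m≡m%n+[m/n]*n s (suc l)) ⟩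
    ρ (s % suc l + s / suc l * suc l + t)       ≡⟨ cong ρ (+-comm-suffix (s % suc l) (s / suc l * suc l) t) ⟩
    ρ (s % suc l + t + s / suc l * suc l)       ≡⟨ blockPowerω-periodic (s % suc l + t) (s / suc l) ⟩
    ρ (s % suc l + t)                           ∎
    where
    open ≡-Reasoning
    +-comm-suffix : ∀ x y z → x + y + z ≡ x + z + y
    +-comm-suffix x y z = trans (+-assoc x y z) (trans (cong (x +_) (+-comm y z)) (sym (+-assoc x z y)))

  blockPowerω-b-within : ∀ s → ∃ λ t → t ≤ l × ρ (s + t) ≡ b
  blockPowerω-b-within s with r , r≤l , ρ≗ ← blockPowerω-reduce s =
    l ∸ r , m∸n≤m l r , trans (ρ≗ (l ∸ r)) (trans (cong ρ (m+[n∸m]≡n r≤l)) blockPowerω-b)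

  blockPowerω-a-after-b : ∀ {s t} → ρ s ≡ b → t < l → ρ (s + suc t) ≡ a
  blockPowerω-a-after-b {s} {t} ρₛ t<l with r , r≤l , ρ≗ ← blockPowerω-reduce s with m≤n⇒m<n∨m≡n r≤l
  ... | inj₁ r<l  = contradiction (trans (sym (blockPowerω-a {r} r<l)) ρᵣ) a≢b
    where
    ρᵣ : ρ r ≡ b
    ρᵣ = trans (cong ρ (sym (+-identityʳ r))) (trans (sym (ρ≗ 0)) (trans (cong ρ (+-identityʳ s)) ρₛ))
  ... | inj₂ refl = trans (ρ≗ (suc t)) (trans (cong ρ (+-suc l t)) (trans (blockPowerω-suc-l t) (blockPowerω-a {t} t<l)))

  blockPowerω-gapped : Gapped l ρ
  blockPowerω-gapped = record
    { b-ahead   = λ p → let t , t≤l , ρₜ = blockPowerω-b-within p in t , m≤n⇒m≤1+n t≤l , ρₜ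
    ; a-after-b = λ {s} {t} → blockPowerω-a-after-b {s} {t}
    }

  applyCA-blockPowerω : ∀ s → applyCA l ρ s ≡ b
  applyCA-blockPowerω s with t , t≤l , ρₜ ← blockPowerω-b-within s = ⇒applyCA≡b l ρ {s} {t} t≤l ρₜ

  blockPowerω-windows-distinct : ∀ {i j m} → i < j → j ≤ l → l ≤ m → window ρ i m ≢ window ρ j m
  blockPowerω-windows-distinct {i} {j} {m} i<j j≤l l≤m same =
    a≢b (trans (sym (blockPowerω-a {i + t} i+t<l))
               (trans (window-≡⇒≡ ρ ρ {i} {j} m same {t} t<m) (trans (cong ρ (m+[n∸m]≡n j≤l)) blockPowerω-b)))
    where
    t = l ∸ j
    t<m : t < m
    t<m = <-≤-trans (∸-monoʳ-< (≤-<-trans z≤n i<j) j≤l) l≤m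
    i+t<l : i + t < l
    i+t<l = subst (i + t <_) (m+[n∸m]≡n j≤l) (+-monoˡ-< t i<j)

  blockPower≡window : ∀ k → blockPower l k ≡ window ρ 0 (k * suc l)
  blockPower≡window zero    = refl
  blockPower≡window (suc k) = begin
    (replicate l a ∷ʳ b) ++ blockPower l k
      ≡⟨ cong₂ _++_ first-block (blockPower≡window k) ⟩
    applyUpTo ρ (suc l) ++ applyUpTo ρ (k * suc l)
      ≡⟨ cong (applyUpTo ρ (suc l) ++_) (applyUpTo-cong (k * suc l) λ {t} _ → sym (blockPowerω-suc-l t)) ⟩
    applyUpTo ρ (suc l) ++ applyUpTo (λ t → ρ (suc l + t)) (k * suc l)
      ≡⟨ applyUpTo-++ ρ (suc l) (k * suc l) ⟨
    applyUpTo ρ (suc l + k * suc l) ∎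
    where
    open ≡-Reasoning
    first-block : replicate l a ∷ʳ b ≡ applyUpTo ρ (suc l)
    first-block = trans (cong₂ _∷ʳ_ (trans (sym (applyUpTo-const a l)) (applyUpTo-cong l (λ t<l → sym (blockPowerω-a t<l))))
                                    (sym blockPowerω-b))
                        (applyUpTo-∷ʳ ρ l)

stateLetter : ℕ → Letter
stateLetter zero    = b
stateLetter (suc _) = a

module _ {l} (lens : ℕ → ℕ) (first≤ : lens 0 ≤ suc l)
         (l≤lens : ∀ k → l ≤ lens (suc k)) (lens≤ : ∀ k → lens (suc k) ≤ suc l) where

  private
    state = blockState lens

    next : ℕ × ℕ → ℕ × ℕ
    next (zero  , k) = lens (suc k) , suc k
    next (suc r , k) = r , k

    state-suc : ∀ p → state (suc p) ≡ next (state p)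
    state-suc p with blockState lens p
    ... | zero  , _ = refl
    ... | suc _ , _ = refl

    remaining≤ : ∀ p → proj₁ (state p) ≤ suc l
    remaining≤ zero = first≤
    remaining≤ (suc p) rewrite state-suc p with state p | remaining≤ p
    ... | zero  , k | _   = lens≤ k
    ... | suc r , k | r<l = <⇒≤ r<l

    run : ∀ p t {r k} → state p ≡ (t + r , k) → state (p + t) ≡ (r , k)
    run p zero    eq = trans (cong state (+-identityʳ p)) eq
    run p (suc t) {r} {k} eq =
      trans (cong state (+-suc p t)) (trans (state-suc (p + t)) (cong next (run p t (trans eq (cong (_, k) (sym (+-suc t r)))))))

    letter : ∀ p {r} → proj₁ (state p) ≡ r → blockWord lens p ≡ stateLetter r
    letter p eq with proj₁ (blockState lens p)
    ... | zero  = cong stateLetter eq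
    ... | suc _ = cong stateLetter eq

    zero-at-b : ∀ p → blockWord lens p ≡ b → proj₁ (state p) ≡ 0
    zero-at-b p wₚ with proj₁ (blockState lens p)
    ... | zero  = refl
    ... | suc _ = ⊥-elim (a≢b wₚ)

  blockWord-gapped : Gapped l (blockWord lens)
  blockWord-gapped = record { b-ahead = b-ahead′ ; a-after-b = λ {s} → a-after-b′ {s} }
    where
    b-ahead′ : ∀ p → ∃ λ t → t ≤ suc l × blockWord lens (p + t) ≡ b
    b-ahead′ p with state p in eq
    ... | r , k = r , subst (_≤ suc l) (cong proj₁ eq) (remaining≤ p)
                    , letter (p + r) (cong proj₁ (run p r (trans eq (cong (_, k) (sym (+-identityʳ r))))))
    a-after-b′ : ∀ {s t} → blockWord lens s ≡ b → t < l → blockWord lens (s + suc t) ≡ a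
    a-after-b′ {s} {t} wₛ t<l with o , lens≡ ← m≤n⇒∃[o]m+o≡n (≤-trans t<l (l≤lens (proj₂ (state s)))) =
      trans (cong (blockWord lens) (+-suc s t)) (letter (suc s + t) (cong proj₁ (run (suc s) t after-b)))
      where
      k = proj₂ (state s)
      after-b : state (suc s) ≡ (t + suc o , suc k)
      after-b = trans (state-suc s) (trans (cong (λ r → next (r , k)) (zero-at-b s wₛ))
                                           (cong (_, suc k) (trans (sym lens≡) (sym (+-suc t o)))))

vLengths-gapped : ∀ {l₀ l ε} → l₀ ≤ suc l → Gapped l (blockWord (vLengths l₀ l ε))
vLengths-gapped {l₀} {l} {ε} l₀≤ =
  blockWord-gapped (vLengths l₀ l ε) l₀≤ (λ k → m≤m+n l (bit (ε k)))
                   (λ k → subst (l + bit (ε k) ≤_) (+-comm l 1) (+-monoʳ-≤ l (bit≤1 (ε k))))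
  where
  bit≤1 : ∀ x → bit x ≤ 1
  bit≤1 false = z≤n
  bit≤1 true  = s≤s z≤n

module _ {l : ℕ} {v : ℕ → Letter} (gapped : Gapped l v) where

  private
    ρ = blockPowerω l

  a-free⇒blockPowerω-window : ∀ {i m} → (∀ {p} → p + l < m → applyCA l v (i + p) ≡ b) →
                              ∃ λ j → j ≤ l × window v i m ≡ window ρ j m
  a-free⇒blockPowerω-window {i} {m} a-free
    with τ , τ≤ , v_iτ ← b-ahead gapped i
    with r , r≤τ , v_ir , before ← first-b-from v i v_iτ
    with r ≤? l
  ... | yes r≤l = l ∸ r , m∸n≤m l r , window-cong v ρ {i} {l ∸ r} m (λ {t} → Agree-join initial later {t} z≤n)
    where
    j = l ∸ r
    j+r≡l : j + r ≡ l
    j+r≡l = m∸n+n≡m r≤l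
    f = λ t → v (i + t)
    g = λ t → ρ (j + t)
    initial : Agree f g 0 r
    initial {t} _ t<r = trans (before t<r) (sym (blockPowerω-a {t = j + t} (subst (j + t <_) j+r≡l (+-monoʳ-< j t<r))))
    later : Agree f g r m
    later = agree-rightwards (Gapped-shift gapped i) (Gapped-shift blockPowerω-gapped j) m v_ir
              (trans (cong ρ j+r≡l) blockPowerω-b)
              λ {x} x+l<m → trans (applyCA-shift l v i x) (trans (a-free x+l<m)
                              (sym (trans (applyCA-shift l ρ j x) (applyCA-blockPowerω (j + x)))))
  ... | no  r≰l = 0 , z≤n , window-cong v ρ {i} {0} m agree
    where
    all-a : ∀ {t} → t ≤ l → v (i + t) ≡ a
    all-a t≤l = before (≤-<-trans t≤l (≰⇒> r≰l))
    agree : ∀ {t} → t < m → v (i + t) ≡ ρ t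
    agree {t} t<m with l <? m
    ... | yes l<m = contradiction (trans (sym (⇒applyCA≡a l v all-a))
                                         (trans (cong (applyCA l v) (sym (+-identityʳ i))) (a-free l<m)))
                                  a≢b
    ... | no  l≮m = trans (all-a (<⇒≤ t<l)) (sym (blockPowerω-a {t = t} t<l))
      where
      t<l = <-≤-trans t<m (≮⇒≥ l≮m)

  occurrence-extends : ∀ {p k} → window v p (suc k * suc l) ≡ window ρ 0 (suc k * suc l) →
                       window v p (suc k * suc l + l) ≡ window ρ 0 (suc k * suc l + l)
  occurrence-extends {p} {k} occ = window-cong v ρ {p} {0} (N + l) extended
    where
    N = suc k * suc l
    last = k * suc l + l
    last<N : last < N
    last<N = subst (_< N) (+-comm l (k * suc l)) (+-monoˡ-< (k * suc l) (n<1+n l))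
    v-last : v (p + last) ≡ b
    v-last = trans (window-≡⇒≡ v ρ {p} {0} N occ last<N)
                   (trans (cong ρ (+-comm (k * suc l) l)) (trans (blockPowerω-periodic l k) blockPowerω-b))
    extended : ∀ {t} → t < N + l → v (p + t) ≡ ρ t
    extended {t} t<N+l with t <? N
    ... | yes t<N = window-≡⇒≡ v ρ {p} {0} N occ t<N
    ... | no  t≮N with s , refl ← m≤n⇒∃[o]m+o≡n (≮⇒≥ t≮N) =
      trans (subst (λ z → v z ≡ a) (position p k l s) (a-after-b gapped v-last s<l))
            (sym (trans (cong ρ (+-comm N s)) (trans (blockPowerω-periodic s (suc k)) (blockPowerω-a {t = s} s<l))))
      where
      s<l : s < l
      s<l = +-cancelˡ-< N s l t<N+l
      position : ∀ p k l s → p + (k * suc l + l) + suc s ≡ p + (suc k * suc l + s)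
      position = solve-∀

  windows-of-occurrence : ∀ {p k j m} → window v p (suc k * suc l) ≡ window ρ 0 (suc k * suc l) →
                          j + m ≤ suc k * suc l + l → window v (p + j) m ≡ window ρ j m
  windows-of-occurrence {p} {k} {j} {m} occ j+m≤ = window-cong v ρ {p + j} {j} m λ {t} t<m →
    trans (cong v (+-assoc p j t))
          (window-≡⇒≡ v ρ {p} {0} _ (occurrence-extends {p} {k} occ) (<-≤-trans (+-monoʳ-< j t<m) j+m≤))

  blockPower-factor⇔ : ∀ {k} → Factor v (blockPower l k) ⇔ ∃ λ p → window v p (k * suc l) ≡ window ρ 0 (k * suc l)
  blockPower-factor⇔ {k} = subst (λ w → Factor v w ⇔ (∃ λ p → window v p (k * suc l) ≡ window ρ 0 (k * suc l)))
                                 (sym (blockPower≡window {l} k)) (Factor-window⇔ v ρ 0 (k * suc l))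

  blockPower-one : Factor v (blockPower l 1)
  blockPower-one with τ , _ , v_b ← b-ahead gapped (suc (suc l)) =
    Equivalence.from (blockPower-factor⇔ {1}) (suc (suc τ) , window-cong v ρ {suc (suc τ)} {0} (suc l + 0) one-block)
    where
    v-b : v (suc (suc τ) + l) ≡ b
    v-b = trans (cong (λ x → v (suc (suc x))) (+-comm τ l)) v_b
    one-block : ∀ {t} → t < suc l + 0 → v (suc (suc τ) + t) ≡ ρ t
    one-block {t} t<1+l with m≤n⇒m<n∨m≡n (≤-pred (subst (t <_) (+-identityʳ (suc l)) t<1+l))
    ... | inj₁ t<l  = trans (a-before-b gapped (s≤s (s≤s z≤n)) v-b t<l) (sym (blockPowerω-a {t = t} t<l))
    ... | inj₂ refl = trans v-b (sym blockPowerω-b)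

  -- A window violating the bound contains b (a^l b)^k from offset l ∸ j on; at a recurrence beyond
  -- position l + 1 that b is preceded by l letters a, giving an occurrence of (a^l b)^{k+1}.
  a-free-window-bound : Sturmian v → ∀ {k} → ¬ Factor v (blockPower l (suc k)) →
                        ∀ {i j m} → j ≤ l → window v i m ≡ window ρ j m → j + m ≤ k * suc l + l
  a-free-window-bound sturmian {k} no-longer {i} {j} {m} j≤l v≡ρ =
    decidable-stable (j + m ≤? k * suc l + l) λ exceeds →
      recurs-beyond _≟ₗ_ {v} sturmian i m (suc (suc l)) λ (i′ , 2+l≤i′ , same) →
        no-longer (Equivalence.from (blockPower-factor⇔ {suc k}) (longer exceeds (trans same v≡ρ) 2+l≤i′))
    where
    N = suc k * suc l
    longer : ¬ (j + m ≤ k * suc l + l) → ∀ {i′} → window v i′ m ≡ window ρ j m → suc (suc l) ≤ i′ →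
             ∃ λ p → window v p N ≡ window ρ 0 N
    longer exceeds {i′} v≡ρ′ 2+l≤i′ with p , refl ← m≤n⇒∃[o]m+o≡n (≤-trans (m≤n⇒m≤1+n (m≤n⇒m≤1+n j≤l)) 2+l≤i′) =
      p , window-cong v ρ {p} {0} N occurrence
      where
      N≤j+m : N ≤ j + m
      N≤j+m = subst (_≤ j + m) (cong suc (+-comm (k * suc l) l)) (≰⇒> exceeds)
      2≤p : 2 ≤ p
      2≤p = +-cancelˡ-≤ j 2 p (≤-trans (≤-reflexive (+-comm j 2)) (≤-trans (s≤s (s≤s j≤l)) 2+l≤i′))
      far : ∀ {t} → j ≤ t → t < N → v (p + t) ≡ ρ t
      far {t} j≤t t<N with u , refl ← m≤n⇒∃[o]m+o≡n j≤t =
        trans (cong v (trans (sym (+-assoc p j u)) (cong (_+ u) (+-comm p j))))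
              (window-≡⇒≡ v ρ {j + p} {j} m v≡ρ′ (+-cancelˡ-< j u m (<-≤-trans t<N N≤j+m)))
      occurrence : ∀ {t} → t < N → v (p + t) ≡ ρ t
      occurrence {t} t<N with l ≤? t
      ... | yes l≤t = far (≤-trans j≤l l≤t) t<N
      ... | no  l≰t = trans (a-before-b gapped 2≤p (trans (far j≤l (m≤m+n (suc l) _)) blockPowerω-b) t<l)
                            (sym (blockPowerω-a {t = t} t<l))
        where t<l = ≰⇒> l≰t

module _ {l : ℕ} {v : ℕ → Letter} (sturmian : Sturmian v) (gapped : Gapped l v) {k i₀ : ℕ}
         (occ : window v i₀ (suc k * suc l) ≡ window (blockPowerω l) 0 (suc k * suc l))
         (no-longer : ¬ Factor v (blockPower l (suc (suc k)))) (n : ℕ) where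

  private
    ρ = blockPowerω l
    m = n + l
    N = suc k * suc l

    applyCA-padded : ∀ (u : ℕ → Letter) i {p} → p < n → applyCA l (padded b (window u i m)) p ≡ applyCA l u (i + p)
    applyCA-padded u i {p} p<n = applyCA-cong l (padded b (window u i m)) u {p} {i + p} λ {t} t≤l →
      trans (padded-applyUpTo b (λ t → u (i + t)) (+-mono-<-≤ p<n t≤l)) (cong u (sym (+-assoc i p t)))

    Φ : List Letter → List Letter
    Φ x = window (applyCA l (padded b x)) 0 n

    HasA : List Letter → Set
    HasA x = ∃ λ p → p < n × applyCA l (padded b x) p ≡ a

    HasA? : ∀ x → Dec (HasA x)
    HasA? x = anyUpTo? (λ p → applyCA l (padded b x) p ≟ₗ a) n

    bⁿ : List Letter
    bⁿ = window (λ _ → b) 0 n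

    Φ-window : ∀ i → Φ (window v i m) ≡ window (applyCA l v) i n
    Φ-window i = window-cong (applyCA l (padded b (window v i m))) (applyCA l v) {0} {i} n (applyCA-padded v i)

    ¬HasA⇒bⁿ : ∀ {x} → ¬ HasA x → Φ x ≡ bⁿ
    ¬HasA⇒bⁿ {x} ¬A = window-cong (applyCA l (padded b x)) (λ _ → b) {0} {0} n λ p<n → ≢a⇒≡b λ eq → ¬A (_ , p<n , eq)

    HasA⇒≢bⁿ : ∀ {x} → HasA x → Φ x ≢ bⁿ
    HasA⇒≢bⁿ {x} (p , p<n , eq) Φx≡bⁿ =
      a≢b (trans (sym eq) (window-≡⇒≡ (applyCA l (padded b x)) (λ _ → b) {0} {0} n Φx≡bⁿ p<n))

    ¬HasA⇒a-free : ∀ {i} → ¬ HasA (window v i m) → ∀ {p} → p + l < m → applyCA l v (i + p) ≡ b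
    ¬HasA⇒a-free {i} ¬A {p} p+l<m = ≢a⇒≡b λ eq → ¬A (p , p<n , trans (applyCA-padded v i p<n) eq)
      where p<n = +-cancelʳ-< l p n p+l<m

    Φ-injective : ∀ {i i′} → HasA (window v i m) → Φ (window v i m) ≡ Φ (window v i′ m) → window v i m ≡ window v i′ m
    Φ-injective {i} {i′} (p₀ , p₀<n , f-a) same-image =
      window-cong v v {i} {i′} m λ t<m → agree z≤n t<m
      where
      same : ∀ {p} → p < n → applyCA l (λ t → v (i + t)) p ≡ applyCA l (λ t → v (i′ + t)) p
      same {p} p<n = trans (applyCA-shift l v i p)
        (trans (window-≡⇒≡ (applyCA l v) (applyCA l v) {i} {i′} n
                 (trans (sym (Φ-window i)) (trans same-image (Φ-window i′))) p<n)
               (sym (applyCA-shift l v i′ p)))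
      agree = applyCA-injective (Gapped-shift gapped i) (Gapped-shift gapped i′) same p₀<n
                (trans (applyCA-shift l v i p₀) (trans (sym (applyCA-padded v i p₀<n)) f-a))

    a-factors a-free-factors : Factors v m → List (List Letter)
    a-factors      Lv = filter HasA? (words Lv)
    a-free-factors Lv = filter (¬? ∘ HasA?) (words Lv)

  module _ (Lv : Factors v m) where

    private
      LA = a-factors Lv
      LB = a-free-factors Lv

    image-factors : Σ (Factors (applyCA l v) n) λ F → size F ≡ length LA + 1 ⊓ length LB
    image-factors = Factors-image Lv Φ Φ-window (compressedImage HasA? Φ bⁿ (words Lv))
                      (Unique-compressedImage HasA? Φ bⁿ (unique Lv) injective (λ {x} _ → HasA⇒≢bⁿ {x}))
                      (∈-compressedImage⇔ HasA? Φ bⁿ (λ {x} _ → ¬HasA⇒bⁿ {x}))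
                  , length-compressedImage HasA? Φ bⁿ (words Lv)
      where
      injective : ∀ {x y} → x ∈ words Lv → y ∈ words Lv → HasA x → HasA y → Φ x ≡ Φ y → x ≡ y
      injective x∈ y∈ A-x _ with sound Lv x∈ | sound Lv y∈
      ... | i , refl | i′ , refl = Φ-injective A-x

    a-free-count : ∀ T → (∀ {j} → j < T ⇔ (j ≤ l × j + n ≤ N)) → length LB ≡ T
    a-free-count T T-spec =
      trans (Unique-⊆⊇⇒length≡ (≡-dec _≟ₗ_) (filter⁺ (¬? ∘ HasA?) (unique Lv)) distinct LB⊆ ⊆LB) (length-applyUpTo _ T)
      where
      periodic-windows = applyUpTo (λ j → window ρ j m) T
      distinct : Unique periodic-windows
      distinct = applyUpTo⁺₁ _ T λ i<j j<T →
        blockPowerω-windows-distinct {l} i<j (proj₁ (Equivalence.to T-spec j<T)) (m≤n+m l n)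
      bounded : ∀ {i j} → j ≤ l → window v i m ≡ window ρ j m → window ρ j m ∈ periodic-windows
      bounded {i} {j} j≤l v≡ρ = ∈-applyUpTo⁺ _ (Equivalence.from T-spec (j≤l , +-cancelʳ-≤ l (j + n) N
        (subst (_≤ N + l) (sym (+-assoc j n l))
               (a-free-window-bound gapped sturmian {suc k} no-longer {i} {j} {m} j≤l v≡ρ))))
      LB⊆ : ∀ {x} → x ∈ LB → x ∈ periodic-windows
      LB⊆ x∈ with x∈Lv , ¬A ← ∈-filter⁻ (¬? ∘ HasA?) x∈ with i , refl ← sound Lv x∈Lv
        with j , j≤l , v≡ρ ← a-free⇒blockPowerω-window gapped (¬HasA⇒a-free ¬A) =
        subst (_∈ periodic-windows) (sym v≡ρ) (bounded j≤l v≡ρ)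
      ⊆LB : ∀ {x} → x ∈ periodic-windows → x ∈ LB
      ⊆LB x∈ with j , j<T , refl ← ∈-applyUpTo⁻ _ x∈ with j≤l , j+n≤N ← Equivalence.to T-spec j<T =
        ∈-filter⁺ (¬? ∘ HasA?)
          (subst (_∈ words Lv) (windows-of-occurrence gapped {i₀} {k} {j} {m} occ j+m≤) (complete Lv (i₀ + j))) no-a
        where
        j+m≤ : j + m ≤ N + l
        j+m≤ = subst (_≤ N + l) (+-assoc j n l) (+-monoˡ-≤ l j+n≤N)
        no-a : ¬ HasA (window ρ j m)
        no-a (p , p<n , eq) = a≢b (trans (sym eq) (trans (applyCA-padded ρ j p<n) (applyCA-blockPowerω (j + p))))

    split-count : length LA + length LB ≡ size Lv
    split-count = length-filter+filter∁ HasA? (words Lv)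

  applyCA-complexity : ∀ T → (∀ {j} → j < T ⇔ (j ≤ l × j + n ≤ N)) →
                       ∃ λ A → A + T ≡ suc (n + l) × HasComplexity (applyCA l v) n (A + 1 ⊓ T)
  applyCA-complexity T T-spec =
    let Lv , |Lv| = complexity⇒factors {u = v} (sturmian m)
        F , |F| = image-factors Lv
        |LB| = a-free-count Lv T T-spec
    in length (a-factors Lv) , trans (cong (length (a-factors Lv) +_) (sym |LB|)) (trans (split-count Lv) |Lv|) ,
       subst (HasComplexity (applyCA l v) n) (trans |F| (cong (λ z → length (a-factors Lv) + 1 ⊓ z) |LB|))
             (factors⇒complexity F)

  complexity-short : n + l ≤ N → HasComplexity (applyCA l v) n (suc n)
  complexity-short n+l≤N =
    let A , A+T≡ , complexity = applyCA-complexity (suc l) spec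
        A≡n = +-cancelʳ-≡ (suc l) A n (trans A+T≡ (sym (+-suc n l)))
    in subst (HasComplexity (applyCA l v) n) (trans (cong (_+ 1) A≡n) (+-comm n 1)) complexity
    where
    spec : ∀ {j} → j < suc l ⇔ (j ≤ l × j + n ≤ N)
    spec = mk⇔ (λ j<1+l → ≤-pred j<1+l , ≤-trans (+-monoˡ-≤ n (≤-pred j<1+l)) (subst (_≤ N) (+-comm n l) n+l≤N))
               (λ (j≤l , _) → s≤s j≤l)

  complexity-middle : N < n + l → n ≤ N → HasComplexity (applyCA l v) n (2 * n + l + 1 ∸ N)
  complexity-middle N<n+l n≤N = conclude (m≤n⇒∃[o]m+o≡n n≤N)
    where
    double : ∀ n l → 2 * n + l + 1 ≡ n + suc (n + l)
    double = solve-∀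
    regroup : ∀ n A d → n + (A + suc d) ≡ A + 1 + (n + d)
    regroup = solve-∀
    conclude : (∃ λ d → n + d ≡ N) → HasComplexity (applyCA l v) n (2 * n + l + 1 ∸ N)
    conclude (d , n+d≡N) =
      let A , A+T≡ , complexity = applyCA-complexity (suc d) spec
          total : 2 * n + l + 1 ≡ A + 1 + N
          total = trans (double n l) (trans (cong (n +_) (sym A+T≡)) (trans (regroup n A d) (cong (A + 1 +_) n+d≡N)))
      in subst (HasComplexity (applyCA l v) n) (sym (trans (cong (_∸ N) total) (m+n∸n≡m (A + 1) N))) complexity
      where
      d<l : d < l
      d<l = +-cancelˡ-< n d l (subst (_< n + l) (sym n+d≡N) N<n+l)
      spec : ∀ {j} → j < suc d ⇔ (j ≤ l × j + n ≤ N)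
      spec {j} = mk⇔ (λ j<1+d → ≤-trans (≤-pred j<1+d) (<⇒≤ d<l) ,
                                 subst (j + n ≤_) (trans (+-comm d n) n+d≡N) (+-monoˡ-≤ n (≤-pred j<1+d)))
                     (λ (_ , j+n≤) → s≤s (+-cancelʳ-≤ n j d (subst (j + n ≤_) (trans (sym n+d≡N) (+-comm n d)) j+n≤)))

  complexity-long : N < n → HasComplexity (applyCA l v) n (n + l + 1)
  complexity-long N<n =
    let A , A+T≡ , complexity = applyCA-complexity 0 spec
    in subst (HasComplexity (applyCA l v) n) (trans A+T≡ (+-comm 1 (n + l))) complexity
    where
    spec : ∀ {j} → j < 0 ⇔ (j ≤ l × j + n ≤ N)
    spec {j} = mk⇔ (λ ()) (λ (_ , j+n≤N) → contradiction (≤-trans (m≤n+m n j) j+n≤N) (<⇒≱ N<n))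

theorem5p5 : (v : ℕ → Letter) (l₀ l : ℕ) (ε : ℕ → Bool) (k₀ : ℕ) →
    Sturmian v → Factor v (a ∷ a ∷ []) →
    Sturmian ε → l₀ ≤ suc l →
    (∀ p → v p ≡ blockWord (vLengths l₀ l ε) p) →
    Factor v (blockPower l k₀) → ¬ Factor v (blockPower l (suc k₀)) →
    let n₀ = k₀ * suc l in
    (∀ n → n + l ≤ n₀ → HasComplexity (applyCA l v) n (suc n))
    × (∀ n → n₀ < n + l → n ≤ n₀ → HasComplexity (applyCA l v) n (2 * n + l + 1 ∸ n₀))
    × (∀ n → n₀ < n → HasComplexity (applyCA l v) n (n + l + 1))
theorem5p5 v l₀ l ε zero _ _ _ l₀≤ v≡ _ no-longer =
  ⊥-elim (no-longer (blockPower-one (Gapped-resp (λ p → sym (v≡ p)) (vLengths-gapped l₀≤))))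
theorem5p5 v l₀ l ε (suc k) sturmian _ _ l₀≤ v≡ occurs no-longer =
  let gapped = Gapped-resp (λ p → sym (v≡ p)) (vLengths-gapped l₀≤)
      i₀ , occ = Equivalence.to (blockPower-factor⇔ gapped {suc k}) occurs
  in (λ n → complexity-short sturmian gapped {k} {i₀} occ no-longer n) ,
     (λ n → complexity-middle sturmian gapped {k} {i₀} occ no-longer n) ,
     (λ n → complexity-long sturmian gapped {k} {i₀} occ no-longer n)
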